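{- Let $\mathbf{h}$ be a weakly increasing sequence of positive integers with $\mathbf{h}(i)>i$ for all $i$, and let $S$ be a nonempty $\mathbf{h}$-admissible set. For each $n\ge \mathbf{j}(S)$, $$\mathcal{I}_\mathbf{h}(S;n)=\sum_{\sigma\in I_\mathbf{h}(S,\mathbf{j}(S))}\binom{n-\mathbf{t}(\sigma)}{\mathbf{j}(S)-\mathbf{t}(\sigma)},$$ where for $\sigma\in I_\mathbf{h}(S,\mathbf{j}(S))$, $\mathbf{t}(\sigma)=\max\{\sigma_k: (k,\mathbf{j}(S)+1)\in\mathcal{P}_\mathbf{h}\}$.
   Context: $\mathcal{P}_\mathbf{h}=\{(i,j): i<j\le \mathbf{h}(i)\}$. For $\pi\in S_n$ (one-line notation $\pi_1\cdots\pi_n$), $\mathrm{inv}_\mathbf{h}(\pi)=\{(i,j)\in\mathcal{P}_\mathbf{h}: j\le n,\ \pi_i>\pi_j\}$. $S\subseteq\mathcal{P}_\mathbf{h}$ is $\mathbf{h}$-admissible if $S=\mathrm{inv}_\mathbf{h}(\pi)$ for some permutation $\pi$ of some $S_n$. $I_\mathbf{h}(S,n)=\{\pi\in S_n:\mathrm{inv}_\mathbf{h}(\pi)=S\}$ and $\mathcal{I}_\mathbf{h}(S;n)=\#I_\mathbf{h}(S,n)$. $\mathbf{j}(S)=\max\{j:(i,j)\in S\}$. -}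

module Defs where

open import Data.Nat using (ℕ; zero; suc; _≤_; _<_; _⊔_; _≤ᵇ_; _<ᵇ_; _≟_; _≤?_; _∸_)
open import Data.Nat.Combinatorics using (_C_)
open import Data.Bool using (Bool; _∧_; if_then_else_)
open import Data.Product using (_×_; _,_; proj₂; Σ; ∃)
open import Data.Product.Properties using (≡-dec)
open import Data.List using (List; []; _∷_; map; concatMap; filter; filterᵇ; upTo; foldr; length)
open import Data.Nat.ListAction using (sum)
open import Data.List.Relation.Unary.All using (All; all?)
open import Data.List.Membership.DecPropositional (≡-dec _≟_ _≟_) using (_∈_; _∈?_)
open import Data.List.Relation.Unary.Unique.DecPropositional _≟_ using (Unique; unique?)
open import Relation.Nullary using (Dec)
open import Relation.Nullary.Decidable using (_×-dec_)
open import Relation.Binary.PropositionalEquality using (_≡_)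

-- Positions and values are 1-based, as in the paper.
-- A permutation π ∈ S_n in one-line notation π₁⋯πₙ is a list of naturals.

range1 : ℕ → List ℕ
range1 n = map suc (upTo n)

-- 1-based lookup: at π k = π_k (default 0 outside 1..length π)
at : List ℕ → ℕ → ℕ
at [] _ = 0
at (x ∷ xs) zero = 0
at (x ∷ xs) (suc zero) = x
at (x ∷ xs) (suc (suc k)) = at xs (suc k)

IsPerm : ℕ → List ℕ → Set
IsPerm n π = (length π ≡ n) × Unique π × All (λ x → (1 ≤ x) × (x ≤ n)) π

isPerm? : (n : ℕ) → (π : List ℕ) → Dec (IsPerm n π)
isPerm? n π = (length π ≟ n) ×-dec (unique? π ×-dec all? (λ x → (1 ≤? x) ×-dec (x ≤? n)) π)

InP : (ℕ → ℕ) → ℕ × ℕ → Set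
InP h (i , j) = (1 ≤ i) × (i < j) × (j ≤ h i)

invh : (ℕ → ℕ) → List ℕ → List (ℕ × ℕ)
invh h π =
  concatMap
    (λ i → map (λ j → (i , j))
       (filterᵇ (λ j → (i <ᵇ j) ∧ ((j ≤ᵇ h i) ∧ (at π j <ᵇ at π i))) (range1 (length π))))
    (range1 (length π))

-- finite subsets of ℕ×ℕ are represented by lists; equality as sets
SameSet : List (ℕ × ℕ) → List (ℕ × ℕ) → Set
SameSet xs ys = All (_∈ ys) xs × All (_∈ xs) ys

sameSet? : (xs ys : List (ℕ × ℕ)) → Dec (SameSet xs ys)
sameSet? xs ys = all? (_∈? ys) xs ×-dec all? (_∈? xs) ys

Admissible : (ℕ → ℕ) → List (ℕ × ℕ) → Set
Admissible h S = Σ ℕ (λ m → Σ (List ℕ) (λ π → IsPerm m π × SameSet (invh h π) S))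

allLists : ℕ → ℕ → List (List ℕ)
allLists zero k = [] ∷ []
allLists (suc n) k = concatMap (λ x → map (x ∷_) (allLists n k)) (range1 k)

Ih : (ℕ → ℕ) → List (ℕ × ℕ) → ℕ → List (List ℕ)
Ih h S n = filter (λ π → isPerm? n π ×-dec sameSet? (invh h π) S) (allLists n n)

countI : (ℕ → ℕ) → List (ℕ × ℕ) → ℕ → ℕ
countI h S n = length (Ih h S n)

jS : List (ℕ × ℕ) → ℕ
jS S = foldr _⊔_ 0 (map proj₂ S)

-- t(σ) = max{ σ_k : (k, J+1) ∈ P_h }, i.e. over 1 ≤ k ≤ J with J+1 ≤ h(k)
tσ : (ℕ → ℕ) → ℕ → List ℕ → ℕ
tσ h J σ = foldr _⊔_ 0 (map (at σ) (filterᵇ (λ k → suc J ≤ᵇ h k) (range1 J)))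

rhs : (ℕ → ℕ) → List (ℕ × ℕ) → ℕ → ℕ
rhs h S n = sum (map (λ σ → (n ∸ tσ h (jS S) σ) C (jS S ∸ tσ h (jS S) σ)) (Ih h S (jS S)))

-- Deleting the last entry v of σ ∈ I_h(S, m+1) and closing the gap at v in the other values
-- gives π ∈ I_h(S, m) as soon as m ≥ j(S). Conversely, inserting a new last value v into π
-- creates exactly the new pairs (k, m+1) ∈ P_h, and none of them may be an inversion; so the
-- admissible v are t(π) < v ≤ m+1, and for each of them t of the extension is v itself,
-- because (m+1, m+2) ∈ P_h. Hence the sum Σ_{σ ∈ I_h(S,m)} C(n − t(σ), m − t(σ)) does not
-- change from m to m+1, by the hockey-stick identity Σ_{v=t+1}^{m+1} C(n−v, m+1−v) = C(n−t, m−t);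
-- at m = j(S) it is the right-hand side, and at m = n every term is 1.

module Submission where

open import Defs
open import Function.Base using (_∘_)
open import Data.Nat using (ℕ; zero; suc; pred; _+_; _∸_; _≤_; _<_; _≤′_; _⊔_; _≤ᵇ_; _<ᵇ_; z≤n; s≤s; z<s; ≤′-refl; ≤′-step)
open import Data.Nat.Properties
open import Data.Nat.Combinatorics using (_C_; nCn≡1; nCk+nC[k+1]≡[n+1]C[k+1])
open import Data.Nat.ListAction using (sum)
open import Data.Nat.ListAction.Properties using (sum-++; sum-↭)
open import Data.Bool using (Bool; _∧_)
open import Data.Bool.Properties using (T-∧)
open import Data.Sum using (inj₁; inj₂)
open import Data.Product using (_×_; _,_; proj₁; proj₂; ∃₂)
open import Data.List using (List; []; _∷_; foldr; _++_; _∷ʳ_; map; concatMap; filterᵇ; cartesianProductWith; length; initLast; _∷ʳ′_)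
open import Data.List.Properties using (foldr-forcesᵇ; foldr-preservesᵇ; length-map; length-++; map-∘; map-cong-local; map-id-local; map-injective; map-concatMap; ∷-injective; ∷ʳ-injective)
open import Data.List.Membership.Propositional using (_∈_; find; lose)
open import Data.List.Membership.Propositional.Properties using (∈-map⁺; ∈-map⁻; ∈-concatMap⁺; ∈-concatMap⁻; ∈-cartesianProductWith⁺; ∈-upTo⁺; ∈-upTo⁻; ∈-filter⁺; ∈-filter⁻)
open import Data.List.Membership.Propositional.Properties.WithK using (unique∧set⇒bag)
open import Data.List.Relation.Unary.Any using (here; there)
open import Data.List.Relation.Unary.All as All using (All; []; _∷_)
import Data.List.Relation.Unary.All.Properties as All
open import Data.List.Relation.Unary.AllPairs as AllPairs using ([]; _∷_)
import Data.List.Relation.Unary.AllPairs.Properties as AllPairs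
open import Data.List.Relation.Unary.Unique.Propositional using (Unique)
import Data.List.Relation.Unary.Unique.Propositional.Properties as Unique
open import Data.List.Relation.Binary.Disjoint.Propositional using (Disjoint)
open import Data.List.Relation.Binary.BagAndSetEquality using (∼bag⇒↭)
open import Data.List.Relation.Binary.Permutation.Propositional using (_↭_)
import Data.List.Relation.Binary.Permutation.Propositional.Properties as ↭
open import Function.Bundles using (_⇔_; mk⇔; Equivalence)
open import Relation.Nullary using (Dec; T?; yes; no; contradiction)
open import Relation.Nullary.Decidable using (_×-dec_)
open import Relation.Binary.PropositionalEquality using (_≡_; _≢_; refl; sym; trans; cong; cong₂; subst; subst₂; module ≡-Reasoning)

private variable
  h : ℕ → ℕ
  i j k m n t v x y : ℕ
  xs ys π : List ℕ
  S : List (ℕ × ℕ)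

∈-range1⁺ : 1 ≤ k → k ≤ n → k ∈ range1 n
∈-range1⁺ {suc k} _ k≤n = ∈-map⁺ suc (∈-upTo⁺ k≤n)

∈-range1⁻ : k ∈ range1 n → 1 ≤ k × k ≤ n
∈-range1⁻ p with _ , q , refl ← ∈-map⁻ suc p = s≤s z≤n , ∈-upTo⁻ q

range1-unique : ∀ n → Unique (range1 n)
range1-unique n = Unique.map⁺ suc-injective (Unique.upTo⁺ n)

at-++ˡ : ∀ xs → k ≤ length xs → at (xs ++ ys) k ≡ at xs k
at-++ˡ {ys = []}    []       z≤n       = refl
at-++ˡ {ys = _ ∷ _} []       z≤n       = refl
at-++ˡ {zero}        (_ ∷ _)  _         = refl
at-++ˡ {suc zero}    (_ ∷ _)  _         = refl
at-++ˡ {suc (suc k)} (_ ∷ xs) (s≤s k≤n) = at-++ˡ xs k≤n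

at-∷ʳ : ∀ xs → at (xs ∷ʳ x) (suc (length xs)) ≡ x
at-∷ʳ []       = refl
at-∷ʳ (_ ∷ xs) = at-∷ʳ xs

at-map : ∀ {f : ℕ → ℕ} → f 0 ≡ 0 → ∀ xs k → at (map f xs) k ≡ f (at xs k)
at-map f0≡0 []       k             = sym f0≡0
at-map f0≡0 (_ ∷ _)  zero          = sym f0≡0
at-map f0≡0 (_ ∷ _)  (suc zero)    = refl
at-map f0≡0 (_ ∷ xs) (suc (suc k)) = at-map f0≡0 xs (suc k)

at-∈ : ∀ xs → 1 ≤ k → k ≤ length xs → at xs k ∈ xs
at-∈ {suc zero}    (_ ∷ _)  _ _         = here refl
at-∈ {suc (suc k)} (_ ∷ xs) _ (s≤s k≤n) = there (at-∈ xs (s≤s z≤n) k≤n)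

maximum : List ℕ → ℕ
maximum = foldr _⊔_ 0

∈⇒≤maximum : x ∈ xs → x ≤ maximum xs
∈⇒≤maximum {xs = xs} =
  All.lookup (foldr-forcesᵇ (λ x y le → m⊔n≤o⇒m≤o x y le , m⊔n≤o⇒n≤o x y le) 0 xs ≤-refl)

maximum<⇔ : 0 < t → maximum xs < t ⇔ All (_< t) xs
maximum<⇔ {xs = xs} 0<t = mk⇔ (foldr-forcesᵇ (λ x y lt → m⊔n<o⇒m<o x y lt , m⊔n<o⇒n<o x y lt) 0 xs)
                                (foldr-preservesᵇ ⊔-pres-<m 0<t)

isHInversionᵇ : (ℕ → ℕ) → List ℕ → ℕ → ℕ → Bool
isHInversionᵇ h π i j = (i <ᵇ j) ∧ ((j ≤ᵇ h i) ∧ (at π j <ᵇ at π i))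

HInversion : (ℕ → ℕ) → List ℕ → ℕ × ℕ → Set
HInversion h π (i , j) = InP h (i , j) × j ≤ length π × at π j < at π i

∈-invh⁻ : ∀ h π {p} → p ∈ invh h π → HInversion h π p
∈-invh⁻ h π p∈
  with i , i∈ , q ← find (∈-concatMap⁻ _ {xs = range1 (length π)} p∈)
  with j , j∈ , refl ← ∈-map⁻ _ q
  with j∈range , test ← ∈-filter⁻ (T? ∘ isHInversionᵇ h π i) j∈
  with i<ᵇj , rest ← Equivalence.to T-∧ test
  with j≤ᵇhi , desc ← Equivalence.to T-∧ rest
  = (proj₁ (∈-range1⁻ i∈) , <ᵇ⇒< _ _ i<ᵇj , ≤ᵇ⇒≤ _ _ j≤ᵇhi) , proj₂ (∈-range1⁻ j∈range) , <ᵇ⇒< _ _ desc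

∈-invh⁺ : ∀ h π {p} → HInversion h π p → p ∈ invh h π
∈-invh⁺ h π {i , j} ((1≤i , i<j , j≤hi) , j≤n , desc) =
  ∈-concatMap⁺ _ (lose (∈-range1⁺ 1≤i (<⇒≤ (<-≤-trans i<j j≤n)))
    (∈-map⁺ (i ,_) (∈-filter⁺ (T? ∘ isHInversionᵇ h π i)
      (∈-range1⁺ (≤-trans 1≤i (<⇒≤ i<j)) j≤n)
      (Equivalence.from T-∧ (<⇒<ᵇ i<j , Equivalence.from T-∧ (≤⇒≤ᵇ j≤hi , <⇒<ᵇ desc))))))

≤-jS : (i , j) ∈ S → j ≤ jS S
≤-jS p = ∈⇒≤maximum (∈-map⁺ proj₂ p)

InRange : ℕ → ℕ → Set
InRange n x = 1 ≤ x × x ≤ n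

allLists-suc : ∀ n k → allLists (suc n) k ≡ cartesianProductWith _∷_ (range1 k) (allLists n k)
allLists-suc n k = go (range1 k)
  where
  go : ∀ xs → concatMap (λ x → map (x ∷_) (allLists n k)) xs ≡ cartesianProductWith _∷_ xs (allLists n k)
  go []       = refl
  go (x ∷ xs) = cong (map (x ∷_) (allLists n k) ++_) (go xs)

∈-allLists : ∀ n → length xs ≡ n → All (InRange k) xs → xs ∈ allLists n k
∈-allLists {xs = []}         zero    refl []         = here refl
∈-allLists {xs = x ∷ xs} {k} (suc n) len  (x∈ ∷ xs∈) =
  subst (x ∷ xs ∈_) (sym (allLists-suc n k))
    (∈-cartesianProductWith⁺ _∷_ (∈-range1⁺ (proj₁ x∈) (proj₂ x∈)) (∈-allLists n (suc-injective len) xs∈))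

allLists-unique : ∀ n k → Unique (allLists n k)
allLists-unique zero    k = [] ∷ []
allLists-unique (suc n) k rewrite allLists-suc n k =
  Unique.cartesianProductWith⁺ _∷_ ∷-injective (range1-unique k) (allLists-unique n k)

inIh? : ∀ h S n π → Dec (IsPerm n π × SameSet (invh h π) S)
inIh? h S n π = isPerm? n π ×-dec sameSet? (invh h π) S

∈-Ih⁻ : π ∈ Ih h S n → IsPerm n π × SameSet (invh h π) S
∈-Ih⁻ {h = h} {S} {n} p = proj₂ (∈-filter⁻ (inIh? h S n) {xs = allLists n n} p)

∈-Ih⁺ : IsPerm n π → SameSet (invh h π) S → π ∈ Ih h S n
∈-Ih⁺ {n} {π} {h} {S} perm@(len , _ , range) same =
  ∈-filter⁺ (inIh? h S n) (∈-allLists n len range) (perm , same)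

Ih-unique : ∀ h S n → Unique (Ih h S n)
Ih-unique h S n = Unique.filter⁺ (inIh? h S n) (allLists-unique n n)

tPositions : (ℕ → ℕ) → ℕ → List ℕ
tPositions h m = filterᵇ (λ k → suc m ≤ᵇ h k) (range1 m)

∈-tPositions⁻ : ∀ h m → k ∈ tPositions h m → InP h (k , suc m)
∈-tPositions⁻ h m p with k∈ , test ← ∈-filter⁻ (λ k → T? (suc m ≤ᵇ h k)) {xs = range1 m} p =
  proj₁ (∈-range1⁻ k∈) , s≤s (proj₂ (∈-range1⁻ k∈)) , ≤ᵇ⇒≤ _ _ test

∈-tPositions⁺ : ∀ h m → InP h (k , suc m) → k ∈ tPositions h m
∈-tPositions⁺ h m (1≤k , s≤s k≤m , m<hk) =
  ∈-filter⁺ (λ k → T? (suc m ≤ᵇ h k)) (∈-range1⁺ 1≤k k≤m) (≤⇒≤ᵇ m<hk)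

≤-tσ : ∀ h σ → InP h (k , suc m) → at σ k ≤ tσ h m σ
≤-tσ {m = m} h σ p = ∈⇒≤maximum (∈-map⁺ (at σ) (∈-tPositions⁺ h m p))

tσ<⇔ : ∀ h σ → 0 < t → tσ h m σ < t ⇔ (∀ {k} → InP h (k , suc m) → at σ k < t)
tσ<⇔ {t} {m} h σ 0<t = mk⇔
  (λ tσ<t {k} p → All.lookup (All.map⁻ (Equivalence.to maximum<t tσ<t)) (∈-tPositions⁺ h m p))
  (λ below → Equivalence.from maximum<t (All.map⁺ (All.tabulate (λ k∈ → below (∈-tPositions⁻ h m k∈)))))
  where
  maximum<t : maximum (map (at σ) (tPositions h m)) < t ⇔ All (_< t) (map (at σ) (tPositions h m))
  maximum<t = maximum<⇔ 0<t

tσ≤ : ∀ h → IsPerm m π → tσ h m π ≤ m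
tσ≤ {m} {π} h (len , _ , range) = ≤-pred (Equivalence.from (tσ<⇔ h π z<s) πk≤m)
  where
  πk≤m : ∀ {k} → InP h (k , suc m) → at π k < suc m
  πk≤m (1≤k , s≤s k≤m , _) = s≤s (proj₂ (All.lookup range (at-∈ π 1≤k (subst (_ ≤_) (sym len) k≤m))))

-- Punching a value in and out, as Data.Fin.punchIn and punchOut do for Fin
punchIn : ℕ → ℕ → ℕ
punchIn v x with v ≤? x
... | yes _ = suc x
... | no  _ = x

punchOut : ℕ → ℕ → ℕ
punchOut v x with v <? x
... | yes _ = pred x
... | no  _ = x

punchIn-< : x < v → punchIn v x ≡ x
punchIn-< {x} {v} x<v with v ≤? x
... | yes v≤x = contradiction v≤x (<⇒≱ x<v)
... | no  _   = refl

punchIn-mono-≤ : ∀ v → x ≤ y → punchIn v x ≤ punchIn v y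
punchIn-mono-≤ {x} {y} v x≤y with v ≤? x | v ≤? y
... | yes _   | yes _   = s≤s x≤y
... | yes v≤x | no  v≰y = contradiction (≤-trans v≤x x≤y) v≰y
... | no  _   | yes _   = m≤n⇒m≤1+n x≤y
... | no  _   | no  _   = x≤y

punchIn-mono-< : ∀ v → x < y → punchIn v x < punchIn v y
punchIn-mono-< {x} {y} v x<y with v ≤? x | v ≤? y
... | yes _   | yes _   = s≤s x<y
... | yes v≤x | no  v≰y = contradiction (≤-trans v≤x (<⇒≤ x<y)) v≰y
... | no  _   | yes _   = m<n⇒m<1+n x<y
... | no  _   | no  _   = x<y

punchIn-cancel-< : ∀ v → punchIn v x < punchIn v y → x < y
punchIn-cancel-< {x} {y} v lt with x <? y
... | yes x<y = x<y
... | no  x≮y = contradiction (punchIn-mono-≤ v (≮⇒≥ x≮y)) (<⇒≱ lt)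

v<punchIn⇔v≤ : v < punchIn v x ⇔ v ≤ x
v<punchIn⇔v≤ {v} {x} with v ≤? x
... | yes v≤x = mk⇔ (λ _ → v≤x) s≤s
... | no  v≰x = mk⇔ (λ v<x → contradiction (<⇒≤ v<x) v≰x) (λ v≤x → contradiction v≤x v≰x)

punchIn≢ : ∀ v x → punchIn v x ≢ v
punchIn≢ v x eq with v ≤? x
... | yes v≤x = <⇒≢ (s≤s v≤x) (sym eq)
... | no  v≰x = v≰x (≤-reflexive (sym eq))

punchIn-inRange : InRange m x → InRange (suc m) (punchIn v x)
punchIn-inRange {x = x} {v} (1≤x , x≤m) with v ≤? x
... | yes _ = s≤s z≤n , s≤s x≤m
... | no  _ = 1≤x , m≤n⇒m≤1+n x≤m

punchOut-punchIn : ∀ v x → punchOut v (punchIn v x) ≡ x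
punchOut-punchIn v x with v ≤? x
... | yes v≤x with v <? suc x
...   | yes _   = refl
...   | no  v≮x = contradiction (s≤s v≤x) v≮x
punchOut-punchIn v x | no v≰x with v <? x
...   | yes v<x = contradiction (<⇒≤ v<x) v≰x
...   | no  _   = refl

punchIn-punchOut : x ≢ v → punchIn v (punchOut v x) ≡ x
punchIn-punchOut {x} {v} x≢v with v <? x
punchIn-punchOut {suc x} {v} x≢v | yes (s≤s v≤x) with v ≤? x
... | yes _   = refl
... | no  v≰x = contradiction v≤x v≰x
punchIn-punchOut {x} {v} x≢v | no v≮x with v ≤? x
... | yes v≤x = contradiction (≤∧≢⇒< v≤x (x≢v ∘ sym)) v≮x
... | no  _   = refl

punchIn-injective : ∀ v → punchIn v x ≡ punchIn v y → x ≡ y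
punchIn-injective {x} {y} v eq = begin
  x                        ≡⟨ sym (punchOut-punchIn v x) ⟩
  punchOut v (punchIn v x) ≡⟨ cong (punchOut v) eq ⟩
  punchOut v (punchIn v y) ≡⟨ punchOut-punchIn v y ⟩
  y                        ∎
  where open ≡-Reasoning

punchOut-inRange : InRange (suc m) v → InRange (suc m) x → x ≢ v → InRange m (punchOut v x)
punchOut-inRange {m} {v} {x} (1≤v , v≤m+1) (1≤x , x≤m+1) x≢v with v <? x
... | yes v<x = ≤-trans 1≤v (pred-mono-≤ v<x) , pred-mono-≤ x≤m+1
... | no  v≮x = 1≤x , ≤-pred (<-≤-trans (≤∧≢⇒< (≮⇒≥ v≮x) x≢v) v≤m+1)

extend : List ℕ → ℕ → List ℕ
extend π v = map (punchIn v) π ∷ʳ v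

length-∷ʳ : ∀ xs → length (xs ∷ʳ x) ≡ suc (length xs)
length-∷ʳ xs = trans (length-++ xs) (+-comm _ 1)

length-extend : ∀ π v → length (extend π v) ≡ suc (length π)
length-extend π v = trans (length-∷ʳ (map (punchIn v) π)) (cong suc (length-map (punchIn v) π))

at-extend : ∀ π → 0 < v → k ≤ length π → at (extend π v) k ≡ punchIn v (at π k)
at-extend {v} {k} π 0<v k≤n = begin
  at (map (punchIn v) π ∷ʳ v) k ≡⟨ at-++ˡ (map (punchIn v) π) (subst (k ≤_) (sym (length-map _ π)) k≤n) ⟩
  at (map (punchIn v) π) k      ≡⟨ at-map (punchIn-< 0<v) π k ⟩
  punchIn v (at π k)            ∎
  where open ≡-Reasoning

at-extend-last : ∀ π v → at (extend π v) (suc (length π)) ≡ v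
at-extend-last π v =
  subst (λ n → at (extend π v) (suc n) ≡ v) (length-map (punchIn v) π) (at-∷ʳ (map (punchIn v) π))

isPerm-extend : IsPerm m π → InRange (suc m) v → IsPerm (suc m) (extend π v)
isPerm-extend {π = π} {v} (len , π-unique , π-range) v-range =
  trans (length-extend π v) (cong suc len) ,
  Unique.++⁺ (Unique.map⁺ (punchIn-injective v) π-unique) ([] ∷ []) v∉ ,
  All.++⁺ (All.map⁺ (All.map punchIn-inRange π-range)) (v-range ∷ [])
  where
  v∉ : Disjoint (map (punchIn v) π) (v ∷ [])
  v∉ (p , here refl) with x , _ , eq ← ∈-map⁻ (punchIn v) p = punchIn≢ v x (sym eq)

extend-injective : ∀ {π π′ v v′} → extend π v ≡ extend π′ v′ → π ≡ π′ × v ≡ v′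
extend-injective {π} {π′} {v} eq with eq′ , refl ← ∷ʳ-injective (map (punchIn v) π) _ eq =
  map-injective (punchIn-injective v) eq′ , refl

unique-∷ʳ⁻ : ∀ xs → Unique (xs ∷ʳ x) → Unique xs × All (_≢ x) xs
unique-∷ʳ⁻ []       _ = [] , []
unique-∷ʳ⁻ (y ∷ xs) (y∉ ∷ xs-unique)
  with y∉xs , y≢x ∷ [] ← All.++⁻ xs y∉
  with xs-unique′ , xs≢x ← unique-∷ʳ⁻ xs xs-unique
  = y∉xs ∷ xs-unique′ , y≢x ∷ xs≢x

isPerm-suc⁻ : ∀ σ → IsPerm (suc m) σ → ∃₂ λ π v → IsPerm m π × InRange (suc m) v × σ ≡ extend π v
isPerm-suc⁻ σ perm with initLast σ
isPerm-suc⁻ .[] (() , _) | []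
isPerm-suc⁻ .(ys ∷ʳ v) (len , σ-unique , σ-range) | ys ∷ʳ′ v
  with ys-unique , ys≢v ← unique-∷ʳ⁻ ys σ-unique
  with ys-range , v-range ∷ [] ← All.++⁻ ys σ-range
  = τ , v ,
    (trans (length-map _ ys) (suc-injective (trans (sym (length-∷ʳ ys)) len)) ,
     Unique.map⁻ (subst Unique (sym punchIn-τ) ys-unique) ,
     All.map⁺ (All.zipWith (λ (r , x≢v) → punchOut-inRange v-range r x≢v) (ys-range , ys≢v))) ,
    v-range , cong (_∷ʳ v) (sym punchIn-τ)
  where
  τ : List ℕ
  τ = map (punchOut v) ys
  punchIn-τ : map (punchIn v) τ ≡ ys
  punchIn-τ = trans (sym (map-∘ ys)) (map-id-local (All.map punchIn-punchOut ys≢v))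

invh-extend⇔ : ∀ h π → 0 < v → j ≤ length π → (i , j) ∈ invh h (extend π v) ⇔ (i , j) ∈ invh h π
invh-extend⇔ {v} {j} {i} h π 0<v j≤n = mk⇔ to from
  where
  at-i : i < j → at (extend π v) i ≡ punchIn v (at π i)
  at-i i<j = at-extend π 0<v (≤-trans (<⇒≤ i<j) j≤n)
  at-j : at (extend π v) j ≡ punchIn v (at π j)
  at-j = at-extend π 0<v j≤n
  to : (i , j) ∈ invh h (extend π v) → (i , j) ∈ invh h π
  to p with inP@(_ , i<j , _) , _ , desc ← ∈-invh⁻ h (extend π v) p =
    ∈-invh⁺ h π (inP , j≤n , punchIn-cancel-< v (subst₂ _<_ at-j (at-i i<j) desc))
  from : (i , j) ∈ invh h π → (i , j) ∈ invh h (extend π v)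
  from p with inP@(_ , i<j , _) , _ , desc ← ∈-invh⁻ h π p =
    ∈-invh⁺ h (extend π v) (inP , subst (j ≤_) (sym (length-extend π v)) (m≤n⇒m≤1+n j≤n) ,
             subst₂ _<_ (sym at-j) (sym (at-i i<j)) (punchIn-mono-< v desc))

invh-extend-last⇔ : ∀ h π → 0 < v →
  (i , suc (length π)) ∈ invh h (extend π v) ⇔ (InP h (i , suc (length π)) × v ≤ at π i)
invh-extend-last⇔ {v} {i} h π 0<v = mk⇔ to from
  where
  at-i : i < suc (length π) → at (extend π v) i ≡ punchIn v (at π i)
  at-i (s≤s i≤n) = at-extend π 0<v i≤n
  to : (i , suc (length π)) ∈ invh h (extend π v) → InP h (i , suc (length π)) × v ≤ at π i
  to p with inP@(_ , i<j , _) , _ , desc ← ∈-invh⁻ h (extend π v) p =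
    inP , Equivalence.to v<punchIn⇔v≤ (subst₂ _<_ (at-extend-last π v) (at-i i<j) desc)
  from : InP h (i , suc (length π)) × v ≤ at π i → (i , suc (length π)) ∈ invh h (extend π v)
  from (inP@(_ , i<j , _) , v≤πi) =
    ∈-invh⁺ h (extend π v) (inP , ≤-reflexive (sym (length-extend π v)) ,
             subst₂ _<_ (sym (at-extend-last π v)) (sym (at-i i<j)) (Equivalence.from v<punchIn⇔v≤ v≤πi))

sameSet-extend⇔ : ∀ h π → length π ≡ m → jS S ≤ m → 0 < v →
  SameSet (invh h (extend π v)) S ⇔ (SameSet (invh h π) S × tσ h m π < v)
sameSet-extend⇔ {S = S} {v} h π refl jS≤m 0<v = mk⇔ to from
  where
  below-jS : ∀ {i j} → (i , j) ∈ S → j ≤ length π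
  below-jS q = ≤-trans (≤-jS q) jS≤m

  to : SameSet (invh h (extend π v)) S → SameSet (invh h π) S × tσ h (length π) π < v
  to (ext⊆S , S⊆ext) =
    (All.tabulate (λ {(i , j)} p → All.lookup ext⊆S
       (Equivalence.from (invh-extend⇔ h π 0<v (proj₁ (proj₂ (∈-invh⁻ h π p)))) p)) ,
     All.tabulate (λ q → Equivalence.to (invh-extend⇔ h π 0<v (below-jS q)) (All.lookup S⊆ext q))) ,
    Equivalence.from (tσ<⇔ h π 0<v) π<v
    where
    π<v : ∀ {k} → InP h (k , suc (length π)) → at π k < v
    π<v {k} inP with at π k <? v
    ... | yes πk<v = πk<v
    ... | no  πk≮v = contradiction
      (below-jS (All.lookup ext⊆S (Equivalence.from (invh-extend-last⇔ h π 0<v) (inP , ≮⇒≥ πk≮v))))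
      (<-irrefl refl)

  from : SameSet (invh h π) S × tσ h (length π) π < v → SameSet (invh h (extend π v)) S
  from ((π⊆S , S⊆π) , tσ<v) =
    All.tabulate ext⊆S ,
    All.tabulate (λ q → Equivalence.from (invh-extend⇔ h π 0<v (below-jS q)) (All.lookup S⊆π q))
    where
    ext⊆S : ∀ {p} → p ∈ invh h (extend π v) → p ∈ S
    ext⊆S {i , j} p
      with m≤n⇒m<n∨m≡n (subst (j ≤_) (length-extend π v) (proj₁ (proj₂ (∈-invh⁻ h (extend π v) p))))
    ... | inj₁ (s≤s j≤n) = All.lookup π⊆S (Equivalence.to (invh-extend⇔ h π 0<v j≤n) p)
    ... | inj₂ refl with inP , v≤πi ← Equivalence.to (invh-extend-last⇔ h π 0<v) p =
      contradiction (Equivalence.to (tσ<⇔ h π 0<v) tσ<v inP) (≤⇒≯ v≤πi)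

tσ-extend : ∀ h π → suc m < h (suc m) → length π ≡ m → tσ h m π < v → tσ h (suc m) (extend π v) ≡ v
tσ-extend {v = v} h π m+1<h refl tσ<v =
  ≤-antisym (≤-pred (Equivalence.from (tσ<⇔ h (extend π v) z<s) ≤v)) v≤
  where
  0<v : 0 < v
  0<v = ≤-<-trans z≤n tσ<v
  ≤v : ∀ {k} → InP h (k , suc (suc (length π))) → at (extend π v) k < suc v
  ≤v {k} (1≤k , s≤s k≤n+1 , n+2≤hk) with m≤n⇒m<n∨m≡n k≤n+1
  ... | inj₁ (s≤s k≤n) = s≤s (<⇒≤ (begin-strict
    at (extend π v) k  ≡⟨ at-extend π 0<v k≤n ⟩
    punchIn v (at π k) ≡⟨ punchIn-< πk<v ⟩
    at π k             <⟨ πk<v ⟩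
    v                  ∎))
    where
    open ≤-Reasoning
    πk<v : at π k < v
    πk<v = Equivalence.to (tσ<⇔ h π 0<v) tσ<v (1≤k , s≤s k≤n , ≤-trans (n≤1+n _) n+2≤hk)
  ... | inj₂ refl = s≤s (≤-reflexive (at-extend-last π v))
  v≤ : v ≤ tσ h (suc (length π)) (extend π v)
  v≤ = subst (_≤ tσ h (suc (length π)) (extend π v)) (at-extend-last π v)
             (≤-tσ h (extend π v) (z<s , ≤-refl , m+1<h))

-- The hockey-stick identity
segment : ℕ → ℕ → List ℕ
segment t zero    = []
segment t (suc k) = suc t ∷ segment (suc t) k

∈-segment⁻ : ∀ t k → v ∈ segment t k → t < v × v ≤ t + k
∈-segment⁻ t (suc k) (here refl) = ≤-refl , subst (suc t ≤_) (sym (+-suc t k)) (s≤s (m≤m+n t k))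
∈-segment⁻ {v} t (suc k) (there p) with t<v , v≤ ← ∈-segment⁻ (suc t) k p =
  <-trans (n<1+n t) t<v , subst (v ≤_) (sym (+-suc t k)) v≤

∈-segment⁺ : ∀ t k → t < v → v ≤ t + k → v ∈ segment t k
∈-segment⁺ {v} t zero    t<v v≤t+0 = contradiction (subst (v ≤_) (+-identityʳ t) v≤t+0) (<⇒≱ t<v)
∈-segment⁺ {v} t (suc k) t<v v≤ with v ≟ suc t
... | yes refl = here refl
... | no  v≢   = there (∈-segment⁺ (suc t) k (≤∧≢⇒< t<v (v≢ ∘ sym)) (subst (v ≤_) (+-suc t k) v≤))

segment-unique : ∀ t k → Unique (segment t k)
segment-unique t zero    = []
segment-unique t (suc k) =
  All.tabulate (λ p → <⇒≢ (proj₁ (∈-segment⁻ (suc t) k p))) ∷ segment-unique (suc t) k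

hockey-stick : ∀ t k → t + k < n →
  sum (map (λ v → (n ∸ v) C (suc (t + k) ∸ v)) (segment t (suc k))) ≡ (n ∸ t) C k
hockey-stick t zero _ rewrite +-identityʳ t | n∸n≡0 t = refl
hockey-stick {n} t (suc k) t+k+1<n = begin
  A C (t + suc k ∸ t) + tail (t + suc k)
    ≡⟨ cong₂ _+_ (cong (A C_) (m+n∸m≡n t (suc k)))
                 (trans (cong tail (+-suc t k)) (hockey-stick (suc t) k (subst (_< n) (+-suc t k) t+k+1<n))) ⟩
  A C suc k + A C k  ≡⟨ +-comm (A C suc k) (A C k) ⟩
  A C k + A C suc k  ≡⟨ nCk+nC[k+1]≡[n+1]C[k+1] A k ⟩
  suc A C suc k      ≡⟨ cong (_C suc k) (sym (+-∸-assoc 1 (≤-<-trans (m≤m+n t (suc k)) t+k+1<n))) ⟩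
  (n ∸ t) C suc k    ∎
  where
  open ≡-Reasoning
  A : ℕ
  A = n ∸ suc t
  tail : ℕ → ℕ
  tail m = sum (map (λ v → (n ∸ v) C (suc m ∸ v)) (segment (suc t) (suc k)))

extensionValues : (ℕ → ℕ) → ℕ → List ℕ → List ℕ
extensionValues h m π = segment (tσ h m π) (suc (m ∸ tσ h m π))

extensions : (ℕ → ℕ) → ℕ → List ℕ → List (List ℕ)
extensions h m π = map (extend π) (extensionValues h m π)

∈-extensionValues⇔ : ∀ h → IsPerm m π → v ∈ extensionValues h m π ⇔ (tσ h m π < v × v ≤ suc m)
∈-extensionValues⇔ {m} {π} {v} h perm = mk⇔
  (λ v∈ → let t<v , v≤ = ∈-segment⁻ _ _ v∈ in t<v , subst (v ≤_) top v≤)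
  (λ (t<v , v≤) → ∈-segment⁺ _ _ t<v (subst (v ≤_) (sym top) v≤))
  where
  top : tσ h m π + suc (m ∸ tσ h m π) ≡ suc m
  top = trans (+-suc (tσ h m π) _) (cong suc (m+[n∸m]≡n (tσ≤ h perm)))

extensions-unique : ∀ h m πs → Unique πs → Unique (concatMap (extensions h m) πs)
extensions-unique h m πs πs-unique =
  Unique.concat⁺
    (All.map⁺ (All.universal (λ π → Unique.map⁺ (proj₂ ∘ extend-injective) (segment-unique _ _)) πs))
    (AllPairs.map⁺ (AllPairs.map disjoint πs-unique))
  where
  disjoint : ∀ {π π′} → π ≢ π′ → Disjoint (extensions h m π) (extensions h m π′)
  disjoint π≢π′ (p , p′)
    with _ , _ , refl ← ∈-map⁻ _ p
    with _ , _ , eq ← ∈-map⁻ _ p′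
    = π≢π′ (proj₁ (extend-injective eq))

Ih-suc↭ : ∀ h S → jS S ≤ m → Ih h S (suc m) ↭ concatMap (extensions h m) (Ih h S m)
Ih-suc↭ {m} h S jS≤m =
  ∼bag⇒↭ (unique∧set⇒bag (Ih-unique h S (suc m)) (extensions-unique h m _ (Ih-unique h S m)) (mk⇔ to from))
  where
  to : ∀ {σ} → σ ∈ Ih h S (suc m) → σ ∈ concatMap (extensions h m) (Ih h S m)
  to {σ} σ∈
    with perm , same ← ∈-Ih⁻ σ∈
    with π , v , π-perm , (0<v , v≤) , refl ← isPerm-suc⁻ σ perm
    with π-same , tσ<v ← Equivalence.to (sameSet-extend⇔ h π (proj₁ π-perm) jS≤m 0<v) same
    = ∈-concatMap⁺ (extensions h m)
        (lose (∈-Ih⁺ π-perm π-same)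
              (∈-map⁺ (extend π) (Equivalence.from (∈-extensionValues⇔ h π-perm) (tσ<v , v≤))))
  from : ∀ {σ} → σ ∈ concatMap (extensions h m) (Ih h S m) → σ ∈ Ih h S (suc m)
  from σ∈
    with π , π∈ , σ∈′ ← find (∈-concatMap⁻ (extensions h m) {xs = Ih h S m} σ∈)
    with v , v∈ , refl ← ∈-map⁻ (extend π) σ∈′
    with π-perm , π-same ← ∈-Ih⁻ π∈
    with tσ<v , v≤ ← Equivalence.to (∈-extensionValues⇔ h π-perm) v∈
    = ∈-Ih⁺ (isPerm-extend π-perm (≤-<-trans z≤n tσ<v , v≤))
            (Equivalence.from (sameSet-extend⇔ h π (proj₁ π-perm) jS≤m (≤-<-trans z≤n tσ<v)) (π-same , tσ<v))

sum-concatMap : ∀ {A : Set} (f : A → List ℕ) xs → sum (concatMap f xs) ≡ sum (map (sum ∘ f) xs)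
sum-concatMap f []       = refl
sum-concatMap f (x ∷ xs) = trans (sum-++ (f x) (concatMap f xs)) (cong (sum (f x) +_) (sum-concatMap f xs))

binomialTerm : (ℕ → ℕ) → ℕ → ℕ → List ℕ → ℕ
binomialTerm h n m σ = (n ∸ tσ h m σ) C (m ∸ tσ h m σ)

binomialSum : (ℕ → ℕ) → List (ℕ × ℕ) → ℕ → ℕ → ℕ
binomialSum h S n m = sum (map (binomialTerm h n m) (Ih h S m))

binomialSum-self : ∀ h S n → binomialSum h S n n ≡ countI h S n
binomialSum-self h S n = go (Ih h S n)
  where
  go : ∀ σs → sum (map (binomialTerm h n n) σs) ≡ length σs
  go []       = refl
  go (σ ∷ σs) = cong₂ _+_ (nCn≡1 (n ∸ tσ h n σ)) (go σs)

sum-extensions : ∀ h → suc m < h (suc m) → IsPerm m π → m < n →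
  sum (map (binomialTerm h n (suc m)) (extensions h m π)) ≡ binomialTerm h n m π
sum-extensions {m} {π} {n} h m+1<h perm m<n = begin
  sum (map (binomialTerm h n (suc m)) (map (extend π) values))
    ≡⟨ cong sum (sym (map-∘ values)) ⟩
  sum (map (binomialTerm h n (suc m) ∘ extend π) values)
    ≡⟨ cong sum (map-cong-local (All.tabulate (cong (λ t → (n ∸ t) C (suc m ∸ t)) ∘ tσ-extension))) ⟩
  sum (map (λ v → (n ∸ v) C (suc m ∸ v)) values)
    ≡⟨ cong (λ m′ → sum (map (λ v → (n ∸ v) C (suc m′ ∸ v)) values)) (sym t+[m∸t]≡m) ⟩
  sum (map (λ v → (n ∸ v) C (suc (tσ h m π + (m ∸ tσ h m π)) ∸ v)) values)
    ≡⟨ hockey-stick (tσ h m π) (m ∸ tσ h m π) (subst (_< n) (sym t+[m∸t]≡m) m<n) ⟩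
  binomialTerm h n m π ∎
  where
  open ≡-Reasoning
  values : List ℕ
  values = extensionValues h m π
  tσ-extension : ∀ {v} → v ∈ values → tσ h (suc m) (extend π v) ≡ v
  tσ-extension v∈ = tσ-extend h π m+1<h (proj₁ perm) (proj₁ (Equivalence.to (∈-extensionValues⇔ h perm) v∈))
  t+[m∸t]≡m : tσ h m π + (m ∸ tσ h m π) ≡ m
  t+[m∸t]≡m = m+[n∸m]≡n (tσ≤ h perm)

binomialSum-suc : ∀ h S → suc m < h (suc m) → jS S ≤ m → m < n → binomialSum h S n (suc m) ≡ binomialSum h S n m
binomialSum-suc {m} {n} h S m+1<h jS≤m m<n = begin
  sum (map (binomialTerm h n (suc m)) (Ih h S (suc m)))
    ≡⟨ sum-↭ (↭.map⁺ _ (Ih-suc↭ h S jS≤m)) ⟩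
  sum (map (binomialTerm h n (suc m)) (concatMap (extensions h m) (Ih h S m)))
    ≡⟨ cong sum (map-concatMap _ (extensions h m) (Ih h S m)) ⟩
  sum (concatMap (map (binomialTerm h n (suc m)) ∘ extensions h m) (Ih h S m))
    ≡⟨ sum-concatMap _ (Ih h S m) ⟩
  sum (map (sum ∘ map (binomialTerm h n (suc m)) ∘ extensions h m) (Ih h S m))
    ≡⟨ cong sum (map-cong-local (All.tabulate (λ π∈ → sum-extensions h m+1<h (proj₁ (∈-Ih⁻ π∈)) m<n))) ⟩
  binomialSum h S n m ∎
  where open ≡-Reasoning

binomialSum-stable : ∀ h S n → (∀ i → 1 ≤ i → i < h i) → jS S ≤′ m → m ≤ n →
  binomialSum h S n m ≡ binomialSum h S n (jS S)
binomialSum-stable h S n h-above ≤′-refl          _   = refl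
binomialSum-stable h S n h-above (≤′-step jS≤′m) m<n =
  trans (binomialSum-suc h S (h-above _ z<s) (≤′⇒≤ jS≤′m) m<n)
        (binomialSum-stable h S n h-above jS≤′m (<⇒≤ m<n))

proposition2p9 : (h : ℕ → ℕ)
    → (∀ i j → 1 ≤ i → i ≤ j → h i ≤ h j)
    → (∀ i → 1 ≤ i → i < h i)
    → (S : List (ℕ × ℕ))
    → S ≢ []
    → Admissible h S
    → (n : ℕ) → jS S ≤ n
    → countI h S n ≡ rhs h S n
proposition2p9 h _ h-above S _ _ n jS≤n = begin
  countI h S n             ≡⟨ binomialSum-self h S n ⟨
  binomialSum h S n n      ≡⟨ binomialSum-stable h S n h-above (≤⇒≤′ jS≤n) ≤-refl ⟩
  binomialSum h S n (jS S) ∎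
  where open ≡-Reasoning
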